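{- Let $u\ge2$ and let $q$ be a prime power with $q\equiv 2^u+1\pmod{2^{u+1}}$. Let $\gamma$ be a primitive element of $\mathbb{F}_q$ and for $h=0,1,\dots,2^u-1$ let $B_h=\bigcup_{j=0}^{2^{u-1}-1}\gamma^{h+j}\langle\gamma^{2^u}\rangle$ (exponents $h+j$ read modulo $2^u$). Then $\{B_i: i=0,1,\dots,2^{u-1}-1\}$ is a skew Hadamard difference family in $(\mathbb{F}_q,+)$.
   Context: Let $(G,+)$ be a finite abelian group of order $v$. A difference family with parameters $(v,k,\lambda)$ in $G$ is a family of $k$-subsets of $G$ (blocks) such that the list of differences $x-y$, $x\ne y$, with $x,y$ in a common block (counted over all blocks) contains every nonzero element of $G$ exactly $\lambda$ times. A block $B$ is skew if $B\cap(-B)=\emptyset$ and $B\cup(-B)=G\setminus\{0_G\}$; a difference family is skew Hadamard if all its blocks are skew. -}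

module Defs where

open import Level using (0ℓ)
open import Data.Nat using (ℕ; zero; suc; _≤_; _^_)
open import Data.Nat.Primality using (Prime)
open import Data.Fin using (Fin)
open import Data.List using (List; length)
open import Data.List.Membership.Propositional using (_∈_)
open import Data.List.Relation.Unary.Unique.Propositional using (Unique)
open import Data.Product using (Σ; ∃; _×_; ∃-syntax; _,_)
open import Data.Sum using (_⊎_)
open import Relation.Nullary using (¬_)
open import Relation.Binary.PropositionalEquality using (_≡_; _≢_)
open import Function.Bundles using (_↔_; _⇔_)
open import Algebra.Structures using (IsCommutativeRing)

open import Data.Nat.Properties using (m^n≢0)

IsPrimePower : ℕ → Set
IsPrimePower q = ∃[ p ] ∃[ n ] (Prime p × 1 ≤ n × q ≡ p ^ n)

record FiniteField (q : ℕ) : Set₁ where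
  infixl 6 _+_
  infixl 7 _*_
  field
    Carrier : Set
    _+_ _*_ : Carrier → Carrier → Carrier
    -_ : Carrier → Carrier
    0# 1# : Carrier
    isCommutativeRing : IsCommutativeRing _≡_ _+_ _*_ -_ 0# 1#
    0≢1 : 0# ≢ 1#
    inverse : ∀ x → x ≢ 0# → ∃[ y ] (x * y ≡ 1#)
    enumeration : Fin q ↔ Carrier

  _-_ : Carrier → Carrier → Carrier
  x - y = x + (- y)

  _^'_ : Carrier → ℕ → Carrier
  x ^' zero = 1#
  x ^' suc n = x * (x ^' n)

module _ {q : ℕ} (F : FiniteField q) where
  open FiniteField F

  Primitive : Carrier → Set
  Primitive γ = γ ≢ 0# × (∀ x → x ≢ 0# → ∃[ k ] (γ ^' k ≡ x))

HasSize : (A : Set) → (A → Set) → ℕ → Set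
HasSize A P n = Σ (List A) λ xs → length xs ≡ n × Unique xs × (∀ a → (a ∈ xs) ⇔ P a)

module _ {q : ℕ} (F : FiniteField q) where
  open FiniteField F

  IsDifferenceFamily : (v k lam b : ℕ) → (Fin b → Carrier → Set) → Set
  IsDifferenceFamily v k lam b B =
    v ≡ q
    × (∀ i → HasSize Carrier (B i) k)
    × (∀ g → g ≢ 0# →
         HasSize (Fin b × Carrier × Carrier)
           (λ { (i , x , y) → B i x × B i y × x ≢ y × x - y ≡ g }) lam)

  IsSkew : (Carrier → Set) → Set
  IsSkew B =
    (∀ x → ¬ (B x × B (- x)))
    × (∀ x → (B x ⊎ B (- x)) ⇔ (x ≢ 0#))

  IsSkewHadamardDF : (v k lam b : ℕ) → (Fin b → Carrier → Set) → Set
  IsSkewHadamardDF v k lam b B = IsDifferenceFamily v k lam b B × (∀ i → IsSkew (B i))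

  open import Data.Nat using (_<_; _%_; _∸_)
  open import Data.Nat using () renaming (_+_ to _+ℕ_)
  Bh : (u : ℕ) → Carrier → ℕ → Carrier → Set
  Bh u γ h x = ∃[ j ] ∃[ m ]
    (j < 2 ^ (u ∸ 1) × x ≡ (γ ^' (_%_ (h +ℕ j) (2 ^ u) {{m^n≢0 2 u}})) * ((γ ^' (2 ^ u)) ^' m))

-- Let N = q − 1 = (2t + 1)·2H be the order of the primitive element γ and e = N/2. Then
-- γ^e = −1 and e ≡ H (mod 2H), and γ^k lies in B_h exactly when (k − h) mod 2H < H. So
-- B_h ∩ −B_h = ∅ and B_h ∪ −B_h = F*, γB_h = B_{h+1}, and −B_H = B_0, i.e. γB_{H−1} = −B_0.
-- Consequently all blocks are images of B_0, and multiplication by γ maps the triples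
-- (i, x, y) with x, y ∈ B_i and x − y = g bijectively onto those with difference γg, shifting
-- i cyclically (and swapping x, y when i wraps around). As γ generates F*, every nonzero g is
-- represented equally often.
module Submission where

open import Algebra.Bundles using (CommutativeRing)
open import Data.Empty using (⊥-elim)
open import Data.Fin as Fin using (Fin; toℕ)
import Data.Fin.Properties as Fin
open import Data.Fin.Relation.Unary.Top using (view; ‵fromℕ; ‵inject₁; view-fromℕ; view-inject₁)
open import Data.List using (map; filter; length; allFin)
open import Data.List.Properties using (length-map)
open import Data.List.Membership.Propositional using (_∈_)
open import Data.List.Membership.Propositional.Properties
  using (∈-map⁺; ∈-map⁻; ∈-filter⁺; ∈-filter⁻; ∈-allFin)
import Data.List.Relation.Unary.Unique.Propositional.Properties as Unique
open import Data.Nat as ℕ using (ℕ; zero; suc; _+_; _^_; _<_; _≤_; _∸_; _%_; _/_)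
open import Data.Nat.DivMod
open import Data.Nat.Divisibility using (_∣_; divides)
import Data.Nat.Properties as ℕₚ
open import Data.Nat.Properties using (m^n≢0)
open import Data.Nat.Tactic.RingSolver using (solve-∀)
open import Data.Product using (∃-syntax; _,_; proj₁; proj₂; _×_)
open import Data.Product.Function.NonDependent.Propositional using (_×-⇔_; _×-↔_)
open import Data.Sum using (_⊎_; inj₁; inj₂; [_,_]′)
open import Function.Base using (_∘_; id; flip)
open import Function.Bundles using (Inverse; Injection; Equivalence; _↔_; _⇔_; mk⇔; mk↔ₛ′)
open import Function.Construct.Composition using () renaming (injective to ∘-injective)
open import Function.Definitions using (Injective)
import Function.Properties.Equivalence as ⇔
open import Function.Properties.Inverse using (↔-refl; ↔-sym; ↔-trans; ↔⇒↣)
import Function.Related.Propositional as Related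
open import Level using (0ℓ)
open import Relation.Binary.Definitions using (DecidableEquality; tri<; tri≈; tri>)
open import Relation.Binary.PropositionalEquality
open import Relation.Nullary using (¬_; Dec; yes; no; ¬?; _×-dec_)
open import Relation.Nullary.Decidable as Dec using (via-injection)
import Relation.Unary as U

open import Defs

Least : (ℕ → Set) → ℕ → Set
Least P m = P m × (∀ {j} → j < m → ¬ P j)

module _ {P : ℕ → Set} (P? : U.Decidable P) where
  private
    least-below : ∀ n → (∃[ m ] Least P m) ⊎ (∀ {j} → j < n → ¬ P j)
    least-below zero = inj₂ λ ()
    least-below (suc n) with least-below n
    ... | inj₁ found = inj₁ found
    ... | inj₂ none with P? n
    ...   | yes Pn = inj₁ (n , Pn , none)
    ...   | no ¬Pn = inj₂ λ j<1+n → [ none , (λ { refl → ¬Pn }) ]′ (ℕₚ.m<1+n⇒m<n∨m≡n j<1+n)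

  least : ∀ {n} → P n → ∃[ m ] Least P m
  least {n} Pn = [ id , (λ none → ⊥-elim (none (ℕₚ.n<1+n n) Pn)) ]′ (least-below (suc n))

%-cong-+ʳ : ∀ {a b} c d .{{_ : ℕ.NonZero d}} → a % d ≡ b % d → (a + c) % d ≡ (b + c) % d
%-cong-+ʳ {a} {b} c d a≡b = begin
  (a + c) % d          ≡⟨ %-distribˡ-+ a c d ⟩
  (a % d + c % d) % d  ≡⟨ cong (λ r → (r + c % d) % d) a≡b ⟩
  (b % d + c % d) % d  ≡⟨ %-distribˡ-+ b c d ⟨
  (b + c) % d          ∎
  where open ≡-Reasoning

[m+n%d]%d≡[m+n]%d : ∀ m n d .{{_ : ℕ.NonZero d}} → (m + n % d) % d ≡ (m + n) % d
[m+n%d]%d≡[m+n]%d m n d = begin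
  (m + n % d) % d          ≡⟨ %-distribˡ-+ m (n % d) d ⟩
  (m % d + n % d % d) % d  ≡⟨ cong (λ r → (m % d + r) % d) (m%n%n≡m%n n d) ⟩
  (m % d + n % d) % d      ≡⟨ %-distribˡ-+ m n d ⟨
  (m + n) % d              ∎
  where open ≡-Reasoning

module _ {A : Set} where

  hasSize-cong : ∀ {P Q : A → Set} {n} (σ : A ↔ A) → (∀ a → P a ⇔ Q (Inverse.to σ a)) →
                 HasSize A P n → HasSize A Q n
  hasSize-cong {P} {Q} σ P⇔Q (xs , |xs|≡n , xs-unique , ∈xs⇔P) =
    map to xs , trans (length-map to xs) |xs|≡n , Unique.map⁺ (Injection.injective (↔⇒↣ σ)) xs-unique ,
    λ b → mk⇔ (∈⇒Q b) (Q⇒∈ b)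
    where
    open Inverse σ using (to; from; strictlyInverseˡ)
    ∈⇒Q : ∀ b → b ∈ map to xs → Q b
    ∈⇒Q b b∈ with ∈-map⁻ to b∈
    ... | a , a∈xs , refl = Equivalence.to (P⇔Q a) (Equivalence.to (∈xs⇔P a) a∈xs)
    Q⇒∈ : ∀ b → Q b → b ∈ map to xs
    Q⇒∈ b Qb =
      subst (_∈ map to xs) (strictlyInverseˡ b) (∈-map⁺ to (Equivalence.from (∈xs⇔P (from b)) P-from-b))
      where
      P-from-b : P (from b)
      P-from-b = Equivalence.from (P⇔Q (from b)) (subst Q (sym (strictlyInverseˡ b)) Qb)

  hasSize-dec : ∀ {P : A → Set} {n} → Fin n ↔ A → U.Decidable P → ∃[ k ] HasSize A P k
  hasSize-dec {P} {n} enum P? =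
    length (filter P? xs) , filter P? xs , refl ,
    Unique.filter⁺ P? (Unique.map⁺ (Injection.injective (↔⇒↣ enum)) (Unique.allFin⁺ n)) ,
    λ a → mk⇔ (proj₂ ∘ ∈-filter⁻ P? {xs = xs}) (∈-filter⁺ P? (∈xs a))
    where
    open Inverse enum using (to; from; strictlyInverseˡ)
    xs = map to (allFin n)
    ∈xs : ∀ a → a ∈ xs
    ∈xs a = subst (_∈ xs) (strictlyInverseˡ a) (∈-map⁺ to (∈-allFin (from a)))

module FieldProperties {q : ℕ} (F : FiniteField q) where
  open FiniteField F hiding (_+_)

  commutativeRing : CommutativeRing 0ℓ 0ℓ
  commutativeRing = record { isCommutativeRing = isCommutativeRing }

  open CommutativeRing commutativeRing public
    using (*-assoc; *-comm; *-identityˡ; *-identityʳ; zeroʳ; semiring; ring)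
  open import Algebra.Properties.Ring ring public
    using (-‿involutive; -‿injective; -0#≈0#; -‿distribˡ-*; -1*x≈-x; x[y-z]≈xy-xz; ⁻¹-anti-homo‿-;
           x∙y⁻¹≈ε⇒x≈y)
  open import Algebra.Properties.Semiring.Exp semiring using (^-homo-*; ^-assocʳ) renaming (_^_ to _^ᴿ_)
  open ≡-Reasoning

  infix 4 _≟_
  _≟_ : DecidableEquality Carrier
  _≟_ = via-injection (↔⇒↣ (↔-sym enumeration)) Fin._≟_

  module _ {a : Carrier} (a≢0 : a ≢ 0#) where
    private
      a⁻¹ = proj₁ (inverse a a≢0)

      cancel : ∀ {b c} → b * c ≡ 1# → ∀ z → b * (c * z) ≡ z
      cancel {b} {c} bc≡1 z = begin
        b * (c * z)  ≡⟨ *-assoc b c z ⟨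
        b * c * z    ≡⟨ cong (_* z) bc≡1 ⟩
        1# * z       ≡⟨ *-identityˡ z ⟩
        z            ∎

    scaling : Carrier ↔ Carrier
    scaling = mk↔ₛ′ (a *_) (a⁻¹ *_) (cancel (proj₂ (inverse a a≢0)))
                                    (cancel (trans (*-comm a⁻¹ a) (proj₂ (inverse a a≢0))))

    *-cancelˡ : ∀ {x y} → a * x ≡ a * y → x ≡ y
    *-cancelˡ = Injection.injective (↔⇒↣ scaling)

  *-nonzero : ∀ {a b} → a ≢ 0# → b ≢ 0# → a * b ≢ 0#
  *-nonzero {a} {b} a≢0 b≢0 ab≡0 = b≢0 (*-cancelˡ a≢0 (trans ab≡0 (sym (zeroʳ a))))

  sqrt1≢1⇒≡-1 : ∀ {y} → y * y ≡ 1# → y ≢ 1# → y ≡ - 1#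
  sqrt1≢1⇒≡-1 {y} y²≡1 y≢1 = *-cancelˡ y-1≢0 (begin
    (y - 1#) * y        ≡⟨ *-comm (y - 1#) y ⟩
    y * (y - 1#)        ≡⟨ x[y-z]≈xy-xz y y 1# ⟩
    (y * y) - (y * 1#)  ≡⟨ cong₂ _-_ y²≡1 (*-identityʳ y) ⟩
    1# - y              ≡⟨ ⁻¹-anti-homo‿- y 1# ⟨
    - (y - 1#)          ≡⟨ -1*x≈-x (y - 1#) ⟨
    - 1# * (y - 1#)     ≡⟨ *-comm (- 1#) (y - 1#) ⟩
    (y - 1#) * - 1#     ∎)
    where
    y-1≢0 : y - 1# ≢ 0#
    y-1≢0 = y≢1 ∘ x∙y⁻¹≈ε⇒x≈y y 1#

  Diff : (Carrier → Set) → Carrier → Carrier → Carrier → Set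
  Diff P g x y = P x × P y × x ≢ y × x - y ≡ g

  Diff? : ∀ {P} → U.Decidable P → ∀ g x y → Dec (Diff P g x y)
  Diff? P? g x y = P? x ×-dec P? y ×-dec ¬? (x ≟ y) ×-dec (x - y ≟ g)

  Diff-scale : ∀ {P Q : Carrier → Set} {c} → c ≢ 0# → (∀ x → P x ⇔ Q (c * x)) →
               ∀ g x y → Diff P g x y ⇔ Diff Q (c * g) (c * x) (c * y)
  Diff-scale {c = c} c≢0 P⇔Q g x y = P⇔Q x ×-⇔ P⇔Q y ×-⇔ ≢⇔≢ ×-⇔ -≡⇔-≡
    where
    ≢⇔≢ : x ≢ y ⇔ c * x ≢ c * y
    ≢⇔≢ = mk⇔ (λ x≢y → x≢y ∘ *-cancelˡ c≢0) (λ cx≢cy → cx≢cy ∘ cong (c *_))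
    -≡⇔-≡ : x - y ≡ g ⇔ (c * x) - (c * y) ≡ c * g
    -≡⇔-≡ = mk⇔ (λ x-y≡g → trans (sym (x[y-z]≈xy-xz c x y)) (cong (c *_) x-y≡g))
                (λ cx-cy≡cg → *-cancelˡ c≢0 (trans (x[y-z]≈xy-xz c x y) cx-cy≡cg))

  Diff-swap : ∀ {P} g x y → Diff P g x y ⇔ Diff P (- g) y x
  Diff-swap g x y = mk⇔
    (λ (Px , Py , x≢y , x-y≡g) → Py , Px , x≢y ∘ sym , trans (sym (⁻¹-anti-homo‿- x y)) (cong -_ x-y≡g))
    (λ (Py , Px , y≢x , y-x≡-g) → Px , Py , y≢x ∘ sym ,
                                  trans (sym (⁻¹-anti-homo‿- y x)) (trans (cong -_ y-x≡-g) (-‿involutive g)))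

  ^'≡^ᴿ : ∀ x n → x ^' n ≡ x ^ᴿ n
  ^'≡^ᴿ x zero = refl
  ^'≡^ᴿ x (suc n) = cong (x *_) (^'≡^ᴿ x n)

  ^'-homo-* : ∀ x m n → x ^' (m + n) ≡ x ^' m * x ^' n
  ^'-homo-* x m n rewrite ^'≡^ᴿ x (m + n) | ^'≡^ᴿ x m | ^'≡^ᴿ x n = ^-homo-* x m n

  ^'-assocʳ : ∀ x m n → (x ^' m) ^' n ≡ x ^' (m ℕ.* n)
  ^'-assocʳ x m n rewrite ^'≡^ᴿ (x ^' m) n | ^'≡^ᴿ x m | ^'≡^ᴿ x (m ℕ.* n) = ^-assocʳ x m n

  ^'-multiple≡1 : ∀ {x} M → x ^' M ≡ 1# → ∀ t → x ^' (t ℕ.* M) ≡ 1#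
  ^'-multiple≡1         M x^M≡1 zero    = refl
  ^'-multiple≡1 {x = x} M x^M≡1 (suc t) = begin
    x ^' (M + t ℕ.* M)       ≡⟨ ^'-homo-* x M (t ℕ.* M) ⟩
    x ^' M * x ^' (t ℕ.* M)  ≡⟨ cong₂ _*_ x^M≡1 (^'-multiple≡1 M x^M≡1 t) ⟩
    1# * 1#                  ≡⟨ *-identityˡ 1# ⟩
    1#                       ∎

  ^'-reduce-% : ∀ {x} M .{{_ : ℕ.NonZero M}} → x ^' M ≡ 1# → ∀ a → x ^' a ≡ x ^' (a % M)
  ^'-reduce-% {x} M x^M≡1 a = begin
    x ^' a                             ≡⟨ cong (x ^'_) (m≡m%n+[m/n]*n a M) ⟩
    x ^' (a % M + a / M ℕ.* M)         ≡⟨ ^'-homo-* x (a % M) (a / M ℕ.* M) ⟩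
    x ^' (a % M) * x ^' (a / M ℕ.* M)  ≡⟨ cong (x ^' (a % M) *_) (^'-multiple≡1 M x^M≡1 (a / M)) ⟩
    x ^' (a % M) * 1#                  ≡⟨ *-identityʳ (x ^' (a % M)) ⟩
    x ^' (a % M)                       ∎

  ^'-split : ∀ x r m M → x ^' (r + m ℕ.* M) ≡ x ^' r * (x ^' M) ^' m
  ^'-split x r m M = begin
    x ^' (r + m ℕ.* M)       ≡⟨ ^'-homo-* x r (m ℕ.* M) ⟩
    x ^' r * x ^' (m ℕ.* M)  ≡⟨ cong (λ k → x ^' r * x ^' k) (ℕₚ.*-comm m M) ⟩
    x ^' r * x ^' (M ℕ.* m)  ≡⟨ cong (x ^' r *_) (^'-assocʳ x M m) ⟨
    x ^' r * (x ^' M) ^' m   ∎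

module PrimitiveElement {q : ℕ} (F : FiniteField q) (γ : FiniteField.Carrier F) (prim : Primitive F γ) where
  open FiniteField F hiding (_+_)
  open FieldProperties F
  open ≡-Reasoning

  γ≢0 : γ ≢ 0#
  γ≢0 = proj₁ prim

  γ^≢0 : ∀ k → γ ^' k ≢ 0#
  γ^≢0 zero    = 0≢1 ∘ sym
  γ^≢0 (suc k) = *-nonzero γ≢0 (γ^≢0 k)

  zero-or-power : ∀ x → x ≡ 0# ⊎ ∃[ k ] γ ^' k ≡ x
  zero-or-power x with x ≟ 0#
  ... | yes x≡0 = inj₁ x≡0
  ... | no  x≢0 = inj₂ (proj₂ prim x x≢0)

  private
    γ^suc≡1 : ∃[ m ] γ ^' suc m ≡ 1#
    γ^suc≡1 = let m , γ^m≡γ⁻¹ = proj₂ prim γ⁻¹ γ⁻¹≢0 in m , trans (cong (γ *_) γ^m≡γ⁻¹) γγ⁻¹≡1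
      where
      γ⁻¹ = proj₁ (inverse γ γ≢0)
      γγ⁻¹≡1 = proj₂ (inverse γ γ≢0)
      γ⁻¹≢0 : γ⁻¹ ≢ 0#
      γ⁻¹≢0 γ⁻¹≡0 = 0≢1 (trans (sym (zeroʳ γ)) (trans (cong (γ *_) (sym γ⁻¹≡0)) γγ⁻¹≡1))

    order-minimal : ∃[ m ] Least (λ m → γ ^' suc m ≡ 1#) m
    order-minimal = least (λ m → γ ^' suc m ≟ 1#) {proj₁ γ^suc≡1} (proj₂ γ^suc≡1)

  order : ℕ
  order = suc (proj₁ order-minimal)

  instance
    order≢0 : ℕ.NonZero order
    order≢0 = _

  γ^order≡1 : γ ^' order ≡ 1#
  γ^order≡1 = proj₁ (proj₂ order-minimal)

  γ^≢1 : ∀ {s} → 0 < s → s < order → γ ^' s ≢ 1#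
  γ^≢1 {suc j} _ (ℕ.s≤s j<m) = proj₂ (proj₂ order-minimal) j<m

  γ^distinct : ∀ {c d} → c < d → d < order → γ ^' c ≢ γ ^' d
  γ^distinct {c} {d} c<d d<o γ^c≡γ^d = γ^≢1 (ℕₚ.m<n⇒0<n∸m c<d) (ℕₚ.≤-<-trans (ℕₚ.m∸n≤m d c) d<o) γ^[d∸c]≡1
    where
    γ^[d∸c]≡1 : γ ^' (d ∸ c) ≡ 1#
    γ^[d∸c]≡1 = *-cancelˡ (γ^≢0 c) (begin
      γ ^' c * γ ^' (d ∸ c)  ≡⟨ ^'-homo-* γ c (d ∸ c) ⟨
      γ ^' (c + (d ∸ c))     ≡⟨ cong (γ ^'_) (ℕₚ.m+[n∸m]≡n (ℕₚ.<⇒≤ c<d)) ⟩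
      γ ^' d                 ≡⟨ γ^c≡γ^d ⟨
      γ ^' c                 ≡⟨ *-identityʳ (γ ^' c) ⟨
      γ ^' c * 1#            ∎)

  γ^-injective : ∀ {c d} → c < order → d < order → γ ^' c ≡ γ ^' d → c ≡ d
  γ^-injective {c} {d} c<o d<o γ^c≡γ^d with ℕₚ.<-cmp c d
  ... | tri< c<d _ _ = ⊥-elim (γ^distinct c<d d<o γ^c≡γ^d)
  ... | tri≈ _ c≡d _ = c≡d
  ... | tri> _ _ d<c = ⊥-elim (γ^distinct d<c c<o (sym γ^c≡γ^d))

  γ^-injective-% : ∀ {a b} → γ ^' a ≡ γ ^' b → a % order ≡ b % order
  γ^-injective-% {a} {b} γ^a≡γ^b = γ^-injective (m%n<n a order) (m%n<n b order) (begin
    γ ^' (a % order)  ≡⟨ ^'-reduce-% order γ^order≡1 a ⟨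
    γ ^' a            ≡⟨ γ^a≡γ^b ⟩
    γ ^' b            ≡⟨ ^'-reduce-% order γ^order≡1 b ⟩
    γ ^' (b % order)  ∎)

  private
    powerOrZero : Fin (suc order) → Carrier
    powerOrZero Fin.zero    = 0#
    powerOrZero (Fin.suc k) = γ ^' toℕ k

    logOrZero : Carrier → Fin (suc order)
    logOrZero x with zero-or-power x
    ... | inj₁ _       = Fin.zero
    ... | inj₂ (k , _) = Fin.suc (Fin.fromℕ< (m%n<n k order))

    powerOrZero-logOrZero : ∀ x → powerOrZero (logOrZero x) ≡ x
    powerOrZero-logOrZero x with zero-or-power x
    ... | inj₁ x≡0         = sym x≡0
    ... | inj₂ (k , γ^k≡x) = begin
      γ ^' toℕ (Fin.fromℕ< (m%n<n k order))  ≡⟨ cong (γ ^'_) (Fin.toℕ-fromℕ< (m%n<n k order)) ⟩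
      γ ^' (k % order)                       ≡⟨ ^'-reduce-% order γ^order≡1 k ⟨
      γ ^' k                                 ≡⟨ γ^k≡x ⟩
      x                                      ∎

    powerOrZero-injective : Injective _≡_ _≡_ powerOrZero
    powerOrZero-injective {Fin.zero}  {Fin.zero}  _ = refl
    powerOrZero-injective {Fin.zero}  {Fin.suc j} 0≡γ^j = ⊥-elim (γ^≢0 (toℕ j) (sym 0≡γ^j))
    powerOrZero-injective {Fin.suc i} {Fin.zero}  γ^i≡0 = ⊥-elim (γ^≢0 (toℕ i) γ^i≡0)
    powerOrZero-injective {Fin.suc i} {Fin.suc j} γ^i≡γ^j =
      cong Fin.suc (Fin.toℕ-injective (γ^-injective (Fin.toℕ<n i) (Fin.toℕ<n j) γ^i≡γ^j))

    logOrZero-injective : Injective _≡_ _≡_ logOrZero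
    logOrZero-injective {x} {y} log≡log = begin
      x                          ≡⟨ powerOrZero-logOrZero x ⟨
      powerOrZero (logOrZero x)  ≡⟨ cong powerOrZero log≡log ⟩
      powerOrZero (logOrZero y)  ≡⟨ powerOrZero-logOrZero y ⟩
      y                          ∎

  -- Powers of γ below the order, together with 0, enumerate F.
  suc-order≡q : suc order ≡ q
  suc-order≡q = Fin.cantor-schröder-bernstein
    (∘-injective _≡_ _≡_ _≡_ powerOrZero-injective (Injection.injective (↔⇒↣ (↔-sym enumeration))))
    (∘-injective _≡_ _≡_ _≡_ (Injection.injective (↔⇒↣ enumeration)) logOrZero-injective)

module _ {q : ℕ} (F : FiniteField q) where
  open FiniteField F hiding (_+_)

  -- B_h with any H ≥ 1 in place of 2^(u−1): Bh F u γ is CyclotomicUnion F (2^(u−1)) γ.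
  CyclotomicUnion : (H : ℕ) .{{_ : ℕ.NonZero H}} → Carrier → ℕ → Carrier → Set
  CyclotomicUnion H γ h x = ∃[ j ] ∃[ m ]
    (j < H × x ≡ γ ^' (_%_ (h + j) (2 ℕ.* H) {{ℕₚ.m*n≢0 2 H}}) * (γ ^' (2 ℕ.* H)) ^' m)

module CyclotomicUnions {q : ℕ} (F : FiniteField q) (γ : FiniteField.Carrier F) (prim : Primitive F γ)
                        (n t : ℕ) (q≡1+[2t+1]M : q ≡ suc ((2 ℕ.* t + 1) ℕ.* (2 ℕ.* suc n))) where
  open FiniteField F hiding (_+_)
  open FieldProperties F
  open PrimitiveElement F γ prim

  H M e : ℕ
  H = suc n
  M = 2 ℕ.* H
  e = H + t ℕ.* M

  instance
    M≢0 : ℕ.NonZero M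
    M≢0 = _

  B : ℕ → Carrier → Set
  B = CyclotomicUnion F H γ

  M≡H+H : M ≡ H + H
  M≡H+H = cong (H +_) (ℕₚ.+-identityʳ H)

  H<M : H < M
  H<M = ℕₚ.m<m+n H ℕ.z<s

  n<M : n < M
  n<M = ℕₚ.<-trans (ℕₚ.n<1+n n) H<M

  order≡[2t+1]M : order ≡ (2 ℕ.* t + 1) ℕ.* M
  order≡[2t+1]M = ℕₚ.suc-injective (trans suc-order≡q q≡1+[2t+1]M)

  order≡e+e : order ≡ e + e
  order≡e+e = trans order≡[2t+1]M (odd-multiple t H)
    where
    odd-multiple : ∀ t H → (2 ℕ.* t + 1) ℕ.* (2 ℕ.* H) ≡ (H + t ℕ.* (2 ℕ.* H)) + (H + t ℕ.* (2 ℕ.* H))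
    odd-multiple = solve-∀

  γ^e≡-1 : γ ^' e ≡ - 1#
  γ^e≡-1 = sqrt1≢1⇒≡-1 γ^e*γ^e≡1 (γ^≢1 0<e e<order)
    where
    open ≡-Reasoning
    0<e : 0 < e
    0<e = ℕ.z<s
    e<order : e < order
    e<order = subst (e <_) (sym order≡e+e) (ℕₚ.m<m+n e 0<e)
    γ^e*γ^e≡1 : γ ^' e * γ ^' e ≡ 1#
    γ^e*γ^e≡1 = begin
      γ ^' e * γ ^' e  ≡⟨ ^'-homo-* γ e e ⟨
      γ ^' (e + e)     ≡⟨ cong (γ ^'_) order≡e+e ⟨
      γ ^' order       ≡⟨ γ^order≡1 ⟩
      1#               ∎

  -γ^≡γ^[e+] : ∀ k → - (γ ^' k) ≡ γ ^' (e + k)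
  -γ^≡γ^[e+] k = begin
    - (γ ^' k)       ≡⟨ -1*x≈-x (γ ^' k) ⟨
    - 1# * γ ^' k    ≡⟨ cong (_* γ ^' k) γ^e≡-1 ⟨
    γ ^' e * γ ^' k  ≡⟨ ^'-homo-* γ e k ⟨
    γ ^' (e + k)     ∎
    where open ≡-Reasoning

  γ^-injective-%M : ∀ {a b} → γ ^' a ≡ γ ^' b → a % M ≡ b % M
  γ^-injective-%M {a} {b} γ^a≡γ^b = begin
    a % M          ≡⟨ m∣n⇒o%n%m≡o%m M order a M∣order ⟨
    a % order % M  ≡⟨ cong (_% M) (γ^-injective-% {a} {b} γ^a≡γ^b) ⟩
    b % order % M  ≡⟨ m∣n⇒o%n%m≡o%m M order b M∣order ⟩
    b % M          ∎
    where
    open ≡-Reasoning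
    M∣order : M ∣ order
    M∣order = divides (2 ℕ.* t + 1) order≡[2t+1]M

  -- (k − h) mod M, written so that the truncated subtraction never bites.
  offset : ℕ → ℕ → ℕ
  offset h k = (k + (M ∸ h)) % M

  offset-cong : ∀ h {a b} → a % M ≡ b % M → offset h a ≡ offset h b
  offset-cong h {a} {b} = %-cong-+ʳ {a} {b} (M ∸ h) M

  +-∸-cancel : ∀ {h} → h ≤ M → ∀ k → k + h + (M ∸ h) ≡ k + M
  +-∸-cancel {h} h≤M k = trans (ℕₚ.+-assoc k h (M ∸ h)) (cong (k +_) (ℕₚ.m+[n∸m]≡n h≤M))

  offset-start : ∀ {h j} → h ≤ M → j < M → offset h (h + j) ≡ j
  offset-start {h} {j} h≤M j<M = begin
    (h + j + (M ∸ h)) % M  ≡⟨ cong (λ a → (a + (M ∸ h)) % M) (ℕₚ.+-comm h j) ⟩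
    (j + h + (M ∸ h)) % M  ≡⟨ cong (_% M) (+-∸-cancel h≤M j) ⟩
    (j + M) % M            ≡⟨ [m+n]%n≡m%n j M ⟩
    j % M                  ≡⟨ m<n⇒m%n≡m j<M ⟩
    j                      ∎
    where open ≡-Reasoning

  +-offset : ∀ {h} → h ≤ M → ∀ k → (h + offset h k) % M ≡ k % M
  +-offset {h} h≤M k = begin
    (h + offset h k) % M     ≡⟨ [m+n%d]%d≡[m+n]%d h (k + (M ∸ h)) M ⟩
    (h + (k + (M ∸ h))) % M  ≡⟨ cong (_% M) (ℕₚ.+-assoc h k (M ∸ h)) ⟨
    (h + k + (M ∸ h)) % M    ≡⟨ cong (λ a → (a + (M ∸ h)) % M) (ℕₚ.+-comm h k) ⟩
    (k + h + (M ∸ h)) % M    ≡⟨ cong (_% M) (+-∸-cancel h≤M k) ⟩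
    (k + M) % M              ≡⟨ [m+n]%n≡m%n k M ⟩
    k % M                    ∎
    where open ≡-Reasoning

  offset-suc : ∀ {h} → h < M → ∀ k → offset (suc h) (suc k) ≡ offset h k
  offset-suc {h} h<M k = cong (_% M) (begin
    suc k + (M ∸ suc h)  ≡⟨ ℕₚ.+-suc k (M ∸ suc h) ⟨
    k + suc (M ∸ suc h)  ≡⟨ cong (k +_) (ℕₚ.+-∸-assoc 1 h<M) ⟨
    k + (M ∸ h)          ∎)
    where open ≡-Reasoning

  e%M≡H%M : e % M ≡ H % M
  e%M≡H%M = [m+kn]%n≡m%n H t M

  offset-half-turn : ∀ h k → offset h (e + k) ≡ (H + offset h k) % M
  offset-half-turn h k = begin
    (e + k + (M ∸ h)) % M    ≡⟨ cong (_% M) (ℕₚ.+-assoc e k (M ∸ h)) ⟩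
    (e + (k + (M ∸ h))) % M  ≡⟨ %-cong-+ʳ {e} {H} (k + (M ∸ h)) M e%M≡H%M ⟩
    (H + (k + (M ∸ h))) % M  ≡⟨ [m+n%d]%d≡[m+n]%d H (k + (M ∸ h)) M ⟨
    (H + offset h k) % M     ∎
    where open ≡-Reasoning

  offset-0-half-turn : ∀ k → offset 0 (e + k) ≡ offset H k
  offset-0-half-turn k = begin
    (e + k + M) % M    ≡⟨ [m+n]%n≡m%n (e + k) M ⟩
    (e + k) % M        ≡⟨ %-cong-+ʳ {e} {H} k M e%M≡H%M ⟩
    (H + k) % M        ≡⟨ cong (_% M) (ℕₚ.+-comm H k) ⟩
    (k + H) % M        ≡⟨ cong (λ a → (k + a) % M) M∸H≡H ⟨
    (k + (M ∸ H)) % M  ∎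
    where
    open ≡-Reasoning
    M∸H≡H : M ∸ H ≡ H
    M∸H≡H = trans (cong (_∸ H) M≡H+H) (ℕₚ.m+n∸m≡n H H)

  half-turn-low : ∀ {r} → r < H → H ≤ (H + r) % M
  half-turn-low {r} r<H = subst (H ≤_) (sym (m<n⇒m%n≡m H+r<M)) (ℕₚ.m≤m+n H r)
    where
    H+r<M : H + r < M
    H+r<M = subst (H + r <_) (sym M≡H+H) (ℕₚ.+-monoʳ-< H r<H)

  half-turn-high : ∀ {r} → H ≤ r → r < M → (H + r) % M < H
  half-turn-high {r} H≤r r<M = subst (_< H) (sym H+r%M≡r∸H) (ℕₚ.m<n+o⇒m∸n<o r H (subst (r <_) M≡H+H r<M))
    where
    open ≡-Reasoning
    H+r%M≡r∸H : (H + r) % M ≡ r ∸ H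
    H+r%M≡r∸H = begin
      (H + r) % M              ≡⟨ cong (λ a → (H + a) % M) (ℕₚ.m+[n∸m]≡n H≤r) ⟨
      (H + (H + (r ∸ H))) % M  ≡⟨ cong (_% M) (ℕₚ.+-assoc H H (r ∸ H)) ⟨
      (H + H + (r ∸ H)) % M    ≡⟨ cong (λ a → (a + (r ∸ H)) % M) M≡H+H ⟨
      (M + (r ∸ H)) % M        ≡⟨ cong (_% M) (ℕₚ.+-comm M (r ∸ H)) ⟩
      (r ∸ H + M) % M          ≡⟨ [m+n]%n≡m%n (r ∸ H) M ⟩
      (r ∸ H) % M              ≡⟨ m<n⇒m%n≡m (ℕₚ.≤-<-trans (ℕₚ.m∸n≤m r H) r<M) ⟩
      r ∸ H                    ∎

  B-nonzero : ∀ h {x} → B h x → x ≢ 0#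
  B-nonzero h (j , m , _ , x≡) x≡0 =
    γ^≢0 ((h + j) % M + m ℕ.* M) (trans (^'-split γ ((h + j) % M) m M) (trans (sym x≡) x≡0))

  ∈B⇔offset<H : ∀ {h} → h ≤ M → ∀ k → B h (γ ^' k) ⇔ offset h k < H
  ∈B⇔offset<H {h} h≤M k = mk⇔ ⇒ ⇐
    where
    open ≡-Reasoning
    ⇒ : B h (γ ^' k) → offset h k < H
    ⇒ (j , m , j<H , γ^k≡) = subst (_< H) (sym offset≡j) j<H
      where
      r = (h + j) % M
      k≡h+j : k % M ≡ (h + j) % M
      k≡h+j = begin
        k % M              ≡⟨ γ^-injective-%M {k} {r + m ℕ.* M} (trans γ^k≡ (sym (^'-split γ r m M))) ⟩
        (r + m ℕ.* M) % M  ≡⟨ [m+kn]%n≡m%n r m M ⟩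
        r % M              ≡⟨ m%n%n≡m%n (h + j) M ⟩
        r                  ∎
      offset≡j : offset h k ≡ j
      offset≡j = trans (offset-cong h {k} {h + j} k≡h+j) (offset-start h≤M (ℕₚ.<-trans j<H H<M))
    ⇐ : offset h k < H → B h (γ ^' k)
    ⇐ offset<H = offset h k , k / M , offset<H , (begin
      γ ^' k
        ≡⟨ cong (γ ^'_) (m≡m%n+[m/n]*n k M) ⟩
      γ ^' (k % M + k / M ℕ.* M)
        ≡⟨ cong (λ r → γ ^' (r + k / M ℕ.* M)) (+-offset h≤M k) ⟨
      γ ^' ((h + offset h k) % M + k / M ℕ.* M)
        ≡⟨ ^'-split γ ((h + offset h k) % M) (k / M) M ⟩
      γ ^' ((h + offset h k) % M) * (γ ^' M) ^' (k / M)
        ∎)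

  B? : ∀ {h} → h ≤ M → U.Decidable (B h)
  B? {h} h≤M x with zero-or-power x
  ... | inj₁ refl       = no (flip (B-nonzero h) refl)
  ... | inj₂ (k , refl) = Dec.map (⇔.sym (∈B⇔offset<H h≤M k)) (offset h k ℕ.<? H)

  B-transfer : ∀ {h h′} → h ≤ M → h′ ≤ M → (T : Carrier → Carrier) (f : ℕ → ℕ) →
               T 0# ≡ 0# → (∀ k → T (γ ^' k) ≡ γ ^' f k) → (∀ k → offset h′ (f k) ≡ offset h k) →
               ∀ x → B h x ⇔ B h′ (T x)
  B-transfer {h} {h′} h≤M h′≤M T f T0≡0 T-power offset≡ x with zero-or-power x
  ... | inj₁ refl       = mk⇔ (⊥-elim ∘ flip (B-nonzero h) refl) (⊥-elim ∘ flip (B-nonzero h′) T0≡0)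
  ... | inj₂ (k , refl) = begin
    B h (γ ^' k)         ∼⟨ ∈B⇔offset<H h≤M k ⟩
    offset h k < H       ≡⟨ cong (_< H) (offset≡ k) ⟨
    offset h′ (f k) < H  ∼⟨ ⇔.sym (∈B⇔offset<H h′≤M (f k)) ⟩
    B h′ (γ ^' f k)      ≡⟨ cong (B h′) (T-power k) ⟨
    B h′ (T (γ ^' k))    ∎
    where open Related.EquationalReasoning

  B-shift : ∀ {h} → h < M → ∀ x → B h x ⇔ B (suc h) (γ * x)
  B-shift h<M = B-transfer (ℕₚ.<⇒≤ h<M) h<M (γ *_) suc (zeroʳ γ) (λ _ → refl) (offset-suc h<M)

  B-negate : ∀ x → B H x ⇔ B 0 (- x)
  B-negate = B-transfer (ℕₚ.<⇒≤ H<M) ℕ.z≤n -_ (e +_) -0#≈0# -γ^≡γ^[e+] offset-0-half-turn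

  B-wrap : ∀ x → B n x ⇔ B 0 ((- γ) * x)
  B-wrap x = begin
    B n x            ∼⟨ B-shift n<M x ⟩
    B H (γ * x)      ∼⟨ B-negate (γ * x) ⟩
    B 0 (- (γ * x))  ≡⟨ cong (B 0) (-‿distribˡ-* γ x) ⟩
    B 0 ((- γ) * x)  ∎
    where open Related.EquationalReasoning

  B-skew : ∀ {h} → h ≤ M → IsSkew F (B h)
  B-skew {h} h≤M = disjoint , covering
    where
    -γ^∈B⇔ : ∀ k → B h (- (γ ^' k)) ⇔ (H + offset h k) % M < H
    -γ^∈B⇔ k = begin
      B h (- (γ ^' k))          ≡⟨ cong (B h) (-γ^≡γ^[e+] k) ⟩
      B h (γ ^' (e + k))        ∼⟨ ∈B⇔offset<H h≤M (e + k) ⟩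
      offset h (e + k) < H      ≡⟨ cong (_< H) (offset-half-turn h k) ⟩
      (H + offset h k) % M < H  ∎
      where open Related.EquationalReasoning

    disjoint : ∀ x → ¬ (B h x × B h (- x))
    disjoint x (x∈B , -x∈B) with zero-or-power x
    ... | inj₁ refl       = B-nonzero h x∈B refl
    ... | inj₂ (k , refl) = ℕₚ.<⇒≱ (Equivalence.to (-γ^∈B⇔ k) -x∈B)
                                    (half-turn-low (Equivalence.to (∈B⇔offset<H h≤M k) x∈B))

    covering : ∀ x → (B h x ⊎ B h (- x)) ⇔ (x ≢ 0#)
    covering x =
      mk⇔ [ B-nonzero h , (λ -x∈B x≡0 → B-nonzero h -x∈B (trans (cong -_ x≡0) -0#≈0#)) ]′ (cover x)
      where
      cover : ∀ x → x ≢ 0# → B h x ⊎ B h (- x)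
      cover x x≢0 with zero-or-power x
      ... | inj₁ x≡0        = ⊥-elim (x≢0 x≡0)
      ... | inj₂ (k , refl) with offset h k ℕ.<? H
      ...   | yes offset<H = inj₁ (Equivalence.from (∈B⇔offset<H h≤M k) offset<H)
      ...   | no  offset≮H = inj₂ (Equivalence.from (-γ^∈B⇔ k)
                                    (half-turn-high (ℕₚ.≮⇒≥ offset≮H) (m%n<n (k + (M ∸ h)) M)))

  -γ≢0 : - γ ≢ 0#
  -γ≢0 -γ≡0 = γ≢0 (-‿injective (trans -γ≡0 (sym -0#≈0#)))

  toℕ≤M : (i : Fin H) → toℕ i ≤ M
  toℕ≤M i = ℕₚ.<⇒≤ (ℕₚ.<-trans (Fin.toℕ<n i) H<M)

  B-size : ∃[ k ] ∀ (i : Fin H) → HasSize Carrier (B (toℕ i)) k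
  B-size with hasSize-dec enumeration (B? ℕ.z≤n)
  ... | k , B₀-size = k , λ i → size (toℕ i) (Fin.toℕ<n i)
    where
    size : ∀ h → h < H → HasSize Carrier (B h) k
    size zero    _     = B₀-size
    size (suc h) h+1<H =
      hasSize-cong {P = B h} {Q = B (suc h)} (scaling γ≢0) (B-shift (ℕₚ.<-trans h<H H<M)) (size h h<H)
      where
      h<H = ℕₚ.<-trans (ℕₚ.n<1+n h) h+1<H

  Triple : Set
  Triple = Fin H × Carrier × Carrier

  Triple-enumeration : Fin (H ℕ.* (q ℕ.* q)) ↔ Triple
  Triple-enumeration = ↔-trans Fin.*↔× (↔-refl ×-↔ ↔-trans Fin.*↔× (enumeration ×-↔ enumeration))

  Differences : Carrier → Triple → Set
  Differences g (i , x , y) = Diff (B (toℕ i)) g x y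

  -- Multiplication by γ moves block i to block i + 1, except that γ B_{H−1} = −B_0.
  rotate : Triple → Triple
  rotate (i , x , y) with view i
  ... | ‵fromℕ     = Fin.zero , (- γ) * y , (- γ) * x
  ... | ‵inject₁ j = Fin.suc j , γ * x , γ * y

  rotation : Triple ↔ Triple
  rotation = mk↔ₛ′ rotate unrotate rotate-unrotate unrotate-rotate
    where
    open Inverse using (from; strictlyInverseˡ; strictlyInverseʳ)
    γ* -γ* : Carrier ↔ Carrier
    γ*  = scaling γ≢0
    -γ* = scaling -γ≢0

    unrotate : Triple → Triple
    unrotate (Fin.zero  , x , y) = Fin.fromℕ n , from -γ* y , from -γ* x
    unrotate (Fin.suc j , x , y) = Fin.inject₁ j , from γ* x , from γ* y

    rotate-unrotate : ∀ a → rotate (unrotate a) ≡ a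
    rotate-unrotate (Fin.zero , x , y) rewrite view-fromℕ n =
      cong₂ (λ x′ y′ → Fin.zero , x′ , y′) (strictlyInverseˡ -γ* x) (strictlyInverseˡ -γ* y)
    rotate-unrotate (Fin.suc j , x , y) rewrite view-inject₁ j =
      cong₂ (λ x′ y′ → Fin.suc j , x′ , y′) (strictlyInverseˡ γ* x) (strictlyInverseˡ γ* y)

    unrotate-rotate : ∀ a → unrotate (rotate a) ≡ a
    unrotate-rotate (i , x , y) with view i
    ... | ‵fromℕ     =
      cong₂ (λ x′ y′ → Fin.fromℕ n , x′ , y′) (strictlyInverseʳ -γ* x) (strictlyInverseʳ -γ* y)
    ... | ‵inject₁ j =
      cong₂ (λ x′ y′ → Fin.inject₁ j , x′ , y′) (strictlyInverseʳ γ* x) (strictlyInverseʳ γ* y)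

  Differences-rotate : ∀ g a → Differences g a ⇔ Differences (γ * g) (rotate a)
  Differences-rotate g (i , x , y) with view i
  ... | ‵fromℕ rewrite Fin.toℕ-fromℕ n = begin
    Diff (B n) g x y
      ∼⟨ Diff-scale {B n} {B 0} -γ≢0 B-wrap g x y ⟩
    Diff (B 0) ((- γ) * g) ((- γ) * x) ((- γ) * y)
      ∼⟨ Diff-swap {B 0} ((- γ) * g) ((- γ) * x) ((- γ) * y) ⟩
    Diff (B 0) (- ((- γ) * g)) ((- γ) * y) ((- γ) * x)
      ≡⟨ cong (λ c → Diff (B 0) c ((- γ) * y) ((- γ) * x)) -[-γ*g]≡γ*g ⟩
    Diff (B 0) (γ * g) ((- γ) * y) ((- γ) * x)
      ∎
    where
    open Related.EquationalReasoning
    -[-γ*g]≡γ*g : - ((- γ) * g) ≡ γ * g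
    -[-γ*g]≡γ*g = trans (-‿distribˡ-* (- γ) g) (cong (_* g) (-‿involutive γ))
  ... | ‵inject₁ j rewrite Fin.toℕ-inject₁ j =
    Diff-scale {B (toℕ j)} {B (suc (toℕ j))} γ≢0 (B-shift (ℕₚ.<-trans (Fin.toℕ<n j) n<M)) g x y

  Differences-size : ∃[ l ] ∀ g → g ≢ 0# → HasSize Triple (Differences g) l
  Differences-size with hasSize-dec Triple-enumeration (λ (i , x , y) → Diff? (B? (toℕ≤M i)) 1# x y)
  ... | l , Differences₁-size = l , λ g g≢0 → let k , γ^k≡g = proj₂ prim g g≢0 in
                                   subst (λ g → HasSize Triple (Differences g) l) γ^k≡g (size k)
    where
    size : ∀ k → HasSize Triple (Differences (γ ^' k)) l
    size zero    = Differences₁-size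
    size (suc k) = hasSize-cong rotation (Differences-rotate (γ ^' k)) (size k)

  skewHadamard : ∃[ k ] ∃[ l ] IsSkewHadamardDF F q k l H (λ i → B (toℕ i))
  skewHadamard with B-size | Differences-size
  ... | k , B-sizes | l , Differences-sizes =
    k , l , (refl , B-sizes , Differences-sizes) , λ i → B-skew (toℕ≤M i)

cyclotomicUnions-skewHadamard : ∀ {q} (F : FiniteField q) γ → Primitive F γ →
  (H t : ℕ) .{{_ : ℕ.NonZero H}} → q ≡ suc ((2 ℕ.* t + 1) ℕ.* (2 ℕ.* H)) →
  ∃[ k ] ∃[ l ] IsSkewHadamardDF F q k l H (λ i → CyclotomicUnion F H γ (toℕ i))
cyclotomicUnions-skewHadamard F γ prim (suc n) t = CyclotomicUnions.skewHadamard F γ prim n t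

lemma3p5 : (u : ℕ) → 2 ≤ u → (q : ℕ) → IsPrimePower q → _%_ q (2 ^ (u + 1)) {{m^n≢0 2 (u + 1)}} ≡ 2 ^ u + 1 →
    (F : FiniteField q) → (γ : FiniteField.Carrier F) → Primitive F γ →
    ∃[ k ] ∃[ λ' ] IsSkewHadamardDF F q k λ' (2 ^ (u ∸ 1)) (λ i → Bh F u γ (toℕ i))
lemma3p5 (suc u) _ q _ q%D≡2H+1 F γ prim =
  cyclotomicUnions-skewHadamard F γ prim H (q / D) {{m^n≢0 2 u}} q≡1+[2t+1]*2H
  where
  H D : ℕ
  H = 2 ^ u
  D = 2 ^ (suc u + 1)

  instance
    D≢0 : ℕ.NonZero D
    D≢0 = m^n≢0 2 (suc u + 1)

  q≡1+[2t+1]*2H : q ≡ suc ((2 ℕ.* (q / D) + 1) ℕ.* (2 ℕ.* H))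
  q≡1+[2t+1]*2H = begin
    q
      ≡⟨ m≡m%n+[m/n]*n q D ⟩
    q % D + q / D ℕ.* D
      ≡⟨ cong₂ (λ r d → r + q / D ℕ.* d) q%D≡2H+1 (cong (2 ^_) (ℕₚ.+-comm (suc u) 1)) ⟩
    2 ℕ.* H + 1 + q / D ℕ.* (2 ℕ.* (2 ℕ.* H))
      ≡⟨ rearrange (q / D) H ⟩
    suc ((2 ℕ.* (q / D) + 1) ℕ.* (2 ℕ.* H))
      ∎
    where
    open ≡-Reasoning
    rearrange : ∀ t H → 2 ℕ.* H + 1 + t ℕ.* (2 ℕ.* (2 ℕ.* H)) ≡ suc ((2 ℕ.* t + 1) ℕ.* (2 ℕ.* H))
    rearrange = solve-∀
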